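{- For each integer $N\ge 1$ let $F_N=(x_1<x_2<\dots<x_{n})$, $n=|F_N|$, be the Farey sequence of order $N$, with $x_i=h_i/k_i$ in lowest terms, and let $d(N)$ be the $n\times n$ matrix with entries $d_{ij}(N)=h_jk_i-h_ik_j$. Define matrices $\delta(N)$, with rows and columns indexed by $F_N$ in increasing order, recursively as follows. $\delta(1)=\begin{pmatrix}0&-1\\1&0\end{pmatrix}$ (indexed by $0/1,1/1$). Given $\delta(N)$, for each fraction $x\in F_{N+1}\setminus F_N$ let $x^-<x<x^+$ be the two fractions of $F_N$ that are consecutive in $F_N$ and between which $x$ lies. Then $\delta(N+1)$ is indexed by $F_{N+1}$ and is obtained by inserting, at the position of each such $x$, a new row equal to the sum of the rows of $x^-$ and $x^+$ and a new column equal to the sum of the columns of $x^-$ and $x^+$; that is, writing $\epsilon(y)=\{y\}$ if $y\in F_N$ and $\epsilon(y)=\{y^-,y^+\}$ if $y\in F_{N+1}\setminus F_N$, one sets $\delta(N+1)_{xy}=\sum_{u\in\epsilon(x)}\sum_{v\in\epsilon(y)}\delta(N)_{uv}$ for all $x,y\in F_{N+1}$. Then $\delta(N)=d(N)$ for every $N\ge 1$.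
   Context: The Farey sequence $F_N$ of order $N$ is the increasing sequence of all irreducible fractions $h/k$ with $0\le h/k\le 1$ and $1\le k\le N$; e.g. $F_1=(0/1,1/1)$. Each fraction of $F_{N+1}$ not in $F_N$ lies strictly between two fractions that are consecutive in $F_N$. The entry $d_{ij}(N)=h_jk_i-h_ik_j$ is the determinant $\begin{vmatrix}h_j&h_i\\k_j&k_i\end{vmatrix}$, the numerator of $h_j/k_j-h_i/k_i$. -}

module Defs where

open import Data.Nat as ℕ using (ℕ; zero; suc)
open import Data.Integer as ℤ using (ℤ; +_)
open import Data.Rational using (ℚ; _/_; ↥_; ↧_; 0ℚ; 1ℚ; _≟_; _<_)
open import Data.Rational.Properties using (≤-decTotalOrder; _<?_)
open import Data.List using (List; []; _∷_; upTo; map; concatMap; deduplicate; filter; last; head; any)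
open import Data.List.Membership.DecPropositional _≟_ using (_∈?_)
open import Data.Maybe using (fromMaybe)
open import Data.Bool using (if_then_else_)
open import Relation.Nullary using (does)
import Data.List.Sort as Sort
open Sort ≤-decTotalOrder using (sort)

-- All fractions h/k with 1 ≤ k ≤ N, 0 ≤ h ≤ k (as normalised rationals,
-- i.e. in lowest terms, possibly with repetitions).
fareyRaw : ℕ → List ℚ
fareyRaw N = concatMap (λ k → map (λ h → (+ h) / suc k) (upTo (suc (suc k)))) (upTo N)

farey : ℕ → List ℚ
farey N = sort (deduplicate _≟_ (fareyRaw N))

d : ℚ → ℚ → ℤ
d xi xj = (↥ xj) ℤ.* (↧ xi) ℤ.- (↥ xi) ℤ.* (↧ xj)

-- x⁻ and x⁺: the largest element of L below x, and the smallest above x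
-- (for L = F_N and x ∈ F_{N+1} \ F_N these are the consecutive neighbours of x in F_N).
below : ℚ → List ℚ → ℚ
below x L = fromMaybe 0ℚ (last (filter (λ y → y <? x) L))

above : ℚ → List ℚ → ℚ
above x L = fromMaybe 0ℚ (head (filter (λ y → x <? y) L))

ε : ℕ → ℚ → List ℚ
ε N y = if does (y ∈? farey N) then y ∷ [] else below y (farey N) ∷ above y (farey N) ∷ []

sumℤ : List ℤ → ℤ
sumℤ [] = + 0
sumℤ (z ∷ zs) = z ℤ.+ sumℤ zs

δ₁ : ℚ → ℚ → ℤ
δ₁ x y = if does (x ≟ 0ℚ) then (if does (y ≟ 1ℚ) then + 1 else + 0)
         else (if does (x ≟ 1ℚ) then (if does (y ≟ 0ℚ) then ℤ.- (+ 1) else + 0) else + 0)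

-- δ(N) as a function of (row, column) ∈ F_N × F_N (values off F_N are irrelevant);
-- δ 0 is a dummy value (N ≥ 1 in the paper).
δ : ℕ → ℚ → ℚ → ℤ
δ zero x y = + 0
δ (suc zero) x y = δ₁ x y
δ (suc (suc n)) x y =
  sumℤ (concatMap (λ u → map (λ v → δ (suc n) u v) (ε (suc n) y)) (ε (suc n) x))

-- (1) Mediants.  For x ∈ F_{N+1} the list ε N x lies in F_N and its numerators and
--     denominators add up to ↥x and ↧x.  For a new fraction
--     x = h/k (k = N+1) take an inverse b of h modulo k, b·h = 1 + a·k with 1 ≤ b < k, and
--     put x⁻ = a/b, x⁺ = (h−a)/(k−b): these lie in F_N, are adjacent to x (determinant 1),
--     and add up to x.  Strictly between adjacent fractions every denominator is at least
--     the sum of theirs, so no fraction of F_N lies between x⁻ and x⁺: they are the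
--     consecutive neighbours of x in F_N, i.e. what `below` and `above` compute.
-- (2) Bilinearity.  d is bilinear in the vectors (↥, ↧), so a double sum of d over two
--     lists is d applied to the summed vectors.

module Submission where

open import Defs
open import Data.Nat using (ℕ; _≤_)
open import Data.Rational using (ℚ)
open import Data.List.Membership.Propositional using (_∈_)
open import Relation.Binary.PropositionalEquality using (_≡_)

open import Data.Nat using (zero; suc; _+_; _*_; _∸_; _<_; s≤s; z≤n)
import Data.Nat.Properties as ℕP
open import Data.Nat.DivMod
  using (_%_; _/_; m≡m%n+[m/n]*n; m%n<n; %-congˡ; %-remove-+ʳ; %-distribˡ-*; m%n%n≡m%n)
open import Data.Nat.Divisibility using (_∣_; ∣-refl; ∣1⇒≡1; ∣m+n∣m⇒∣n; n∣m*n; ∣-trans; m∣m*n)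
open import Data.Nat.Coprimality as Cop using (Coprime)
open import Data.Nat.GCD as ℕG using (module Bézout)
open import Data.Integer as ℤ using (ℤ; +_; -[1+_]; 1ℤ)
import Data.Integer.Properties as ℤP
open import Data.Rational as ℚ using (mkℚ; ↥_; ↧_; ↧ₙ_; 0ℚ; 1ℚ)
import Data.Rational.Properties as ℚP
open import Data.List using (List; []; _∷_; upTo; map; concatMap; _++_; last; head)
open import Data.List.Membership.Propositional using (find; lose)
open import Data.List.Membership.Propositional.Properties
  using (∈-concatMap⁺; ∈-concatMap⁻; ∈-map⁺; ∈-map⁻; ∈-upTo⁺; ∈-upTo⁻;
         ∈-deduplicate⁺; ∈-deduplicate⁻; ∈-filter⁺; ∈-filter⁻)
open import Data.List.Membership.DecPropositional ℚ._≟_ using (_∈?_)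
open import Data.List.Relation.Binary.Subset.Propositional using (_⊆_)
open import Data.List.Relation.Binary.Permutation.Propositional using (↭-sym)
open import Data.List.Relation.Binary.Permutation.Propositional.Properties using (∈-resp-↭)
open import Data.List.Relation.Unary.Any using (here; there)
open import Data.List.Relation.Unary.Linked using (Linked; [-]; _∷_)
import Data.List.Relation.Unary.Linked.Properties as Linked
open import Data.List.Sort ℚP.≤-decTotalOrder using (sort-↭; sort-↗)
open import Data.Maybe using (just)
open import Data.Product using (∃; ∃₂; _×_; _,_; proj₁; proj₂)
open import Data.Sum using (_⊎_; inj₁; inj₂)
open import Data.Empty using (⊥)
open import Relation.Nullary using (¬_; Dec; yes; no; does)
open import Data.Bool using (if_then_else_)
open import Relation.Binary.PropositionalEquality
  using (refl; sym; trans; cong; cong₂; subst; subst₂; module ≡-Reasoning)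
import Data.Nat.Tactic.RingSolver as ℕRing
import Data.Integer.Tactic.RingSolver as ℤRing

IsFarey : ℕ → ℚ → Set
IsFarey N x = ↧ₙ x ≤ N × + 0 ℤ.≤ ↥ x × ↥ x ℤ.≤ ↧ x

cancel-bounds : ∀ (p : ℤ) (q g h n : ℕ) → p ℤ.* + g ≡ + h → + q ℤ.* + g ≡ + suc n → h ≤ suc n →
                q ≤ suc n × + 0 ℤ.≤ p × p ℤ.≤ + q
cancel-bounds p q zero h n _ qg≡n _ with () ← trans (sym (ℤP.*-zeroʳ (+ q))) qg≡n
cancel-bounds (+ p) q (suc g) h n pg≡h qg≡n h≤n = q≤n , ℤ.+≤+ z≤n , p≤q
  where
  q≤n : q ≤ suc n
  q≤n = ℕP.≤-trans (ℕP.m≤m*n q (suc g))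
          (ℕP.≤-reflexive (ℤP.+-injective (trans (ℤP.pos-* q (suc g)) qg≡n)))
  p≤q : + p ℤ.≤ + q
  p≤q = ℤP.*-cancelʳ-≤-pos (+ p) (+ q) (+ suc g) (subst₂ ℤ._≤_ (sym pg≡h) (sym qg≡n) (ℤ.+≤+ h≤n))
cancel-bounds -[1+ p ] q (suc g) h n () _ _

/-isFarey : ∀ {N} h k → suc k ≤ N → h ≤ suc k → IsFarey N (+ h ℚ./ suc k)
/-isFarey h k k<N h≤k =
  let q≤k , p-bounds = cancel-bounds (↥ (+ h ℚ./ suc k)) (↧ₙ (+ h ℚ./ suc k)) (ℕG.gcd h (suc k)) h k
                         (ℚP.↥-/ (+ h) (suc k)) (ℚP.↧-/ (+ h) (suc k)) h≤k
  in ℕP.≤-trans q≤k k<N , p-bounds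

farey-sound : ∀ N x → x ∈ farey N → IsFarey N x
farey-sound N x x∈F =
  let k , k∈ , x∈k = find (∈-concatMap⁻ _ {xs = upTo N}
                       (∈-deduplicate⁻ ℚ._≟_ (fareyRaw N) (∈-resp-↭ (sort-↭ _) x∈F)))
      h , h∈ , x≡ = ∈-map⁻ _ x∈k
  in subst (IsFarey N) (sym x≡) (/-isFarey h k (∈-upTo⁻ k∈) (ℕP.≤-pred (∈-upTo⁻ h∈)))

farey-complete : ∀ N x → IsFarey N x → x ∈ farey N
farey-complete N x@(mkℚ (+ h) k _) (k<N , _ , ℤ.+≤+ h≤k) =
  ∈-resp-↭ (↭-sym (sort-↭ _)) (∈-deduplicate⁺ ℚ._≟_ (subst (_∈ fareyRaw N) (ℚP.↥p/↧p≡p x)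
    (∈-concatMap⁺ _ (lose (∈-upTo⁺ k<N) (∈-map⁺ _ (∈-upTo⁺ (s≤s h≤k)))))))

Sorted : List ℚ → Set
Sorted = Linked ℚ._≤_

farey-sorted : ∀ N → Sorted (farey N)
farey-sorted N = sort-↗ _

last-max : ∀ {L z} → Sorted L → z ∈ L → ∃ λ l → last L ≡ just l × z ℚ.≤ l × l ∈ L
last-max {x ∷ []} [-] (here refl) = x , refl , ℚP.≤-refl , here refl
last-max {x ∷ y ∷ xs} (x≤y ∷ sorted) (here refl)
  with l , e , y≤l , l∈ ← last-max sorted (here refl) = l , e , ℚP.≤-trans x≤y y≤l , there l∈
last-max {x ∷ y ∷ xs} (_ ∷ sorted) (there z∈)
  with l , e , z≤l , l∈ ← last-max sorted z∈ = l , e , z≤l , there l∈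

head-min : ∀ {L z} → Sorted L → z ∈ L → ∃ λ l → head L ≡ just l × l ℚ.≤ z × l ∈ L
head-min {x ∷ xs} _ (here refl) = x , refl , ℚP.≤-refl , here refl
head-min {x ∷ y ∷ xs} (x≤y ∷ sorted) (there z∈)
  with _ , refl , y≤z , _ ← head-min sorted z∈ = x , refl , ℚP.≤-trans x≤y y≤z , here refl

-- `below x L` is the predecessor a of x in a sorted list L: a ∈ L, a < x, nothing of L in between.
-- (The last element l of L below x satisfies a ≤ l < x, so the gap forces l = a.)
below-unique : ∀ {L x a} → Sorted L → a ∈ L → a ℚ.< x →
               (∀ {y} → y ∈ L → a ℚ.< y → y ℚ.< x → ⊥) → below x L ≡ a
below-unique {L} {x} sorted a∈ a<x gap
  with l , e , a≤l , l∈ ← last-max (Linked.filter⁺ (λ y → y ℚP.<? x) ℚP.≤-trans sorted)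
                                   (∈-filter⁺ (λ y → y ℚP.<? x) a∈ a<x)
  rewrite e
  with l∈L , l<x ← ∈-filter⁻ (λ y → y ℚP.<? x) {xs = L} l∈
  = ℚP.≤-antisym (ℚP.≮⇒≥ (λ a<l → gap l∈L a<l l<x)) a≤l

above-unique : ∀ {L x c} → Sorted L → c ∈ L → x ℚ.< c →
               (∀ {y} → y ∈ L → x ℚ.< y → y ℚ.< c → ⊥) → above x L ≡ c
above-unique {L} {x} sorted c∈ x<c gap
  with l , e , l≤c , l∈ ← head-min (Linked.filter⁺ (λ y → x ℚP.<? y) ℚP.≤-trans sorted)
                                   (∈-filter⁺ (λ y → x ℚP.<? y) c∈ x<c)
  rewrite e
  with l∈L , x<l ← ∈-filter⁻ (λ y → x ℚP.<? y) {xs = L} l∈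
  = ℚP.≤-antisym l≤c (ℚP.≮⇒≥ (λ l<c → gap l∈L x<l l<c))

inverse-mod : ∀ {h n} → Coprime h (2 + n) → ∃ λ x → (x * h) % (2 + n) ≡ 1
inverse-mod {h} {n} coprime with Cop.coprime-Bézout coprime
... | Bézout.+- x y eq = x , (begin
  (x * h) % k        ≡⟨ %-congˡ {o = k} (sym eq) ⟩
  (1 + y * k) % k    ≡⟨ %-remove-+ʳ 1 {d = k} (n∣m*n y) ⟩
  1                  ∎)
  where
  open ≡-Reasoning
  k = 2 + n
... | Bézout.-+ x y eq = x * suc n , (begin
  (x * suc n * h) % k              ≡⟨ %-remove-+ʳ (x * suc n * h) {d = k} ∣-refl ⟨
  (x * suc n * h + k) % k          ≡⟨ %-congˡ {o = k} (shift x (suc n) h) ⟩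
  (1 + suc n * (1 + x * h)) % k    ≡⟨ %-congˡ {o = k} (cong (λ t → 1 + suc n * t) eq) ⟩
  (1 + suc n * (y * k)) % k        ≡⟨ %-remove-+ʳ 1 {d = k} (∣-trans (n∣m*n y) (n∣m*n (suc n))) ⟩
  1                                ∎)
  where
  open ≡-Reasoning
  k = 2 + n
  -- from 1 + x·h ≡ 0 (mod k) and m = k − 1 ≡ −1: (x·m)·h ≡ 1 (mod k)
  shift : ∀ x m h → x * m * h + suc m ≡ 1 + m * (1 + x * h)
  shift = ℕRing.solve-∀

-- The inverse can be chosen in 1 ≤ b < k: then b·h = 1 + a·k.
inverse-reduced : ∀ {h n} → Coprime h (2 + n) → ∃₂ λ b a → b < suc n × suc b * h ≡ 1 + a * (2 + n)
inverse-reduced {h} {n} coprime with x , xh≡1 ← inverse-mod coprime =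
  from-residue (x % k) (m%n<n x k) (begin
    ((x % k) * h) % k              ≡⟨ %-distribˡ-* (x % k) h k ⟩
    ((x % k % k) * (h % k)) % k    ≡⟨ cong (λ t → (t * (h % k)) % k) (m%n%n≡m%n x k) ⟩
    ((x % k) * (h % k)) % k        ≡⟨ %-distribˡ-* x h k ⟨
    (x * h) % k                    ≡⟨ xh≡1 ⟩
    1                              ∎)
  where
  open ≡-Reasoning
  k = 2 + n
  from-residue : ∀ b → b < k → (b * h) % k ≡ 1 → ∃₂ λ b′ a → b′ < suc n × suc b′ * h ≡ 1 + a * k
  from-residue zero _ ()
  from-residue (suc b) (s≤s b<k) bh≡1 = b , (suc b * h) / k , b<k , (begin
    suc b * h                                ≡⟨ m≡m%n+[m/n]*n (suc b * h) k ⟩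
    (suc b * h) % k + (suc b * h) / k * k    ≡⟨ cong (_+ (suc b * h) / k * k) bh≡1 ⟩
    1 + (suc b * h) / k * k                  ∎)

1+i-i≡1 : ∀ i → 1ℤ ℤ.+ i ℤ.- i ≡ 1ℤ
1+i-i≡1 = ℤRing.solve-∀

<⇒d-positive : ∀ {x y} → x ℚ.< y → 1ℤ ℤ.≤ d x y
<⇒d-positive {x} {y} (ℚ.*<* lt) = begin
  1ℤ                   ≡⟨ 1+i-i≡1 i ⟨
  ℤ.suc i ℤ.- i          ≤⟨ ℤP.+-monoˡ-≤ (ℤ.- i) (ℤP.i<j⇒suc[i]≤j lt) ⟩
  d x y                  ∎
  where
  open ℤP.≤-Reasoning
  i = ↥ x ℤ.* ↧ y

d-positive⇒< : ∀ {x y} → 1ℤ ℤ.≤ d x y → x ℚ.< y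
d-positive⇒< {x} {y} 1≤d = ℚ.*<* (ℤP.suc[i]≤j⇒i<j (begin
  ℤ.suc i                ≡⟨⟩
  1ℤ ℤ.+ i             ≤⟨ ℤP.+-monoˡ-≤ i 1≤d ⟩
  d x y ℤ.+ i            ≡⟨ minus-plus (↥ y ℤ.* ↧ x) i ⟩
  ↥ y ℤ.* ↧ x            ∎))
  where
  open ℤP.≤-Reasoning
  i = ↥ x ℤ.* ↧ y
  minus-plus : ∀ j i → j ℤ.- i ℤ.+ i ≡ j
  minus-plus = ℤRing.solve-∀

d-identity : ∀ x y z → ↧ y ℤ.* d x z ≡ ↧ z ℤ.* d x y ℤ.+ ↧ x ℤ.* d y z
d-identity x y z = identity (↥ x) (↧ x) (↥ y) (↧ y) (↥ z) (↧ z)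
  where
  identity : ∀ a b p q c e → q ℤ.* (c ℤ.* b ℤ.- a ℤ.* e)
                           ≡ e ℤ.* (p ℤ.* b ℤ.- a ℤ.* q) ℤ.+ b ℤ.* (c ℤ.* q ℤ.- p ℤ.* e)
  identity = ℤRing.solve-∀

-- Between adjacent fractions x < z (d x z = 1), every y has ↧y ≥ ↧x + ↧z, because
-- ↧y = ↧z·d(x,y) + ↧x·d(y,z) with both determinants ≥ 1.
adjacent-gap : ∀ {x y z} → d x z ≡ 1ℤ → x ℚ.< y → y ℚ.< z → ↧ₙ z + ↧ₙ x ≤ ↧ₙ y
adjacent-gap {x} {y} {z} adjacent x<y y<z = ℤP.drop‿+≤+ (begin
  + (↧ₙ z + ↧ₙ x)                  ≡⟨ ℤP.pos-+ (↧ₙ z) (↧ₙ x) ⟩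
  ↧ z ℤ.+ ↧ x                      ≡⟨ cong₂ ℤ._+_ (ℤP.*-identityʳ (↧ z)) (ℤP.*-identityʳ (↧ x)) ⟨
  ↧ z ℤ.* 1ℤ ℤ.+ ↧ x ℤ.* 1ℤ    ≤⟨ ℤP.+-mono-≤ (ℤP.*-monoˡ-≤-nonNeg (↧ z) (<⇒d-positive x<y))
                                                  (ℤP.*-monoˡ-≤-nonNeg (↧ x) (<⇒d-positive y<z)) ⟩
  ↧ z ℤ.* d x y ℤ.+ ↧ x ℤ.* d y z  ≡⟨ d-identity x y z ⟨
  ↧ y ℤ.* d x z                    ≡⟨ cong (↧ y ℤ.*_) adjacent ⟩
  ↧ y ℤ.* 1ℤ                     ≡⟨ ℤP.*-identityʳ (↧ y) ⟩
  ↧ y                              ∎)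
  where open ℤP.≤-Reasoning

-- The fractions a/b and c/e are unimodular neighbours when b·c = 1 + a·e.
record Unimodular (a b c e : ℕ) : Set where
  constructor unimodular
  field determinant : b * c ≡ suc (a * e)

unimodular-divisor : ∀ {a b c e i} → Unimodular a b c e → i ∣ b * c → i ∣ a * e → i ≡ 1
unimodular-divisor {a} {e = e} {i} (unimodular bc≡) i∣bc i∣ae =
  ∣1⇒≡1 (∣m+n∣m⇒∣n (subst (i ∣_) (trans bc≡ (ℕP.+-comm 1 (a * e))) i∣bc) i∣ae)

unimodular-coprimeˡ : ∀ {a b c e} → Unimodular a b c e → Coprime a b
unimodular-coprimeˡ {c = c} {e} uni (i∣a , i∣b) =
  unimodular-divisor uni (∣-trans i∣b (m∣m*n c)) (∣-trans i∣a (m∣m*n e))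

unimodular-coprimeʳ : ∀ {a b c e} → Unimodular a b c e → Coprime c e
unimodular-coprimeʳ {a} {b} uni (i∣c , i∣e) =
  unimodular-divisor uni (∣-trans i∣c (n∣m*n b)) (∣-trans i∣e (n∣m*n a))

unimodular-det : ∀ {a b c e} → Unimodular a b c e → + c ℤ.* + b ℤ.- + a ℤ.* + e ≡ 1ℤ
unimodular-det {a} {b} {c} {e} (unimodular bc≡) = begin
  + c ℤ.* + b ℤ.- + a ℤ.* + e              ≡⟨ cong₂ ℤ._-_ (ℤP.pos-* c b) (ℤP.pos-* a e) ⟨
  + (c * b) ℤ.- + (a * e)
    ≡⟨ cong (λ t → + t ℤ.- + (a * e)) (trans (ℕP.*-comm c b) bc≡) ⟩
  1ℤ ℤ.+ + (a * e) ℤ.- + (a * e)         ≡⟨ 1+i-i≡1 (+ (a * e)) ⟩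
  1ℤ                                     ∎
  where open ≡-Reasoning

record Parents (N : ℕ) (x : ℚ) : Set where
  field
    left right      : ℚ
    left-farey      : IsFarey N left
    right-farey     : IsFarey N right
    left-adjacent   : d left x ≡ 1ℤ
    right-adjacent  : d x right ≡ 1ℤ
    numerator-sum   : ↥ x ≡ ↥ left ℤ.+ ↥ right
    denominator-sum : ↧ x ≡ ↧ left ℤ.+ ↧ right

-- If b·h = 1 + a·k with 1 ≤ b < k = N + 1 and h ≤ k, the parents of h/k in F_N are
-- a/b and (h − a)/(k − b).  (mkℚ takes the denominator minus one, so b = 1 + bm.)
mediant-parents : ∀ {n h bm a} .(cx : Coprime h (2 + n)) → h ≤ 2 + n → bm < suc n →
                  suc bm * h ≡ 1 + a * (2 + n) → Parents (suc n) (mkℚ (+ h) (suc n) cx)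
mediant-parents {n} {h} {bm} {a} cx h≤k bm<k-1 bh≡ = record
  { left            = mkℚ (+ a) bm (unimodular-coprimeˡ left-unimodular)
  ; right           = mkℚ (+ c) em (unimodular-coprimeʳ right-unimodular)
  ; left-farey      = bm<k-1 , ℤ.+≤+ z≤n , ℤ.+≤+ (ℕP.<⇒≤ a<b)
  ; right-farey     = s≤s (ℕP.m∸n≤m n bm) , ℤ.+≤+ z≤n , ℤ.+≤+ c≤e
  ; left-adjacent   = unimodular-det left-unimodular
  ; right-adjacent  = unimodular-det right-unimodular
  ; numerator-sum   = cong +_ (sym a+c≡h)
  ; denominator-sum = cong +_ (sym b+e≡k)
  }
  where
  k = 2 + n
  b = suc bm
  em = n ∸ bm
  e = suc em
  c = h ∸ a

  left-unimodular : Unimodular a b h k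
  left-unimodular = unimodular bh≡

  -- a·k < b·h ≤ b·k and b·h ≤ k·h give a < b and a < h
  ak<bh : a * k < b * h
  ak<bh = ℕP.≤-reflexive (sym bh≡)

  a<b : a < b
  a<b = ℕP.*-cancelʳ-< k a b (ℕP.<-≤-trans ak<bh (ℕP.*-monoʳ-≤ b h≤k))

  a<h : a < h
  a<h = ℕP.*-cancelʳ-< k a h (ℕP.<-≤-trans ak<bh
          (ℕP.≤-trans (ℕP.*-monoˡ-≤ h (ℕP.<⇒≤ (s≤s bm<k-1))) (ℕP.≤-reflexive (ℕP.*-comm k h))))

  a+c≡h : a + c ≡ h
  a+c≡h = ℕP.m+[n∸m]≡n (ℕP.<⇒≤ a<h)

  b+e≡k : b + e ≡ k
  b+e≡k = cong suc (trans (ℕP.+-suc bm em) (cong suc (ℕP.m+[n∸m]≡n (ℕP.≤-pred bm<k-1))))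

  kc≡ : k * c ≡ suc (h * e)
  kc≡ = ℕP.+-cancelʳ-≡ (a * k) (k * c) (suc (h * e)) (begin
    k * c + a * k        ≡⟨ distrib k a c ⟩
    k * (a + c)          ≡⟨ cong (k *_) a+c≡h ⟩
    k * h                ≡⟨ cong (_* h) b+e≡k ⟨
    (b + e) * h          ≡⟨ ℕP.*-distribʳ-+ h b e ⟩
    b * h + e * h        ≡⟨ cong (_+ e * h) bh≡ ⟩
    suc (a * k) + e * h  ≡⟨ rearrange (a * k) e h ⟩
    suc (h * e) + a * k  ∎)
    where
    open ≡-Reasoning
    distrib : ∀ k a c → k * c + a * k ≡ k * (a + c)
    distrib = ℕRing.solve-∀
    rearrange : ∀ t e h → suc t + e * h ≡ suc (h * e) + t
    rearrange = ℕRing.solve-∀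

  right-unimodular : Unimodular h k c e
  right-unimodular = unimodular kc≡

  -- c·k = 1 + h·e < k + e·k, so c ≤ e (this uses k ≥ 2)
  c≤e : c ≤ e
  c≤e = ℕP.≤-pred (ℕP.*-cancelʳ-< k c (suc e) (begin-strict
    c * k          ≡⟨ ℕP.*-comm c k ⟩
    k * c          ≡⟨ kc≡ ⟩
    suc (h * e)    <⟨ s≤s (s≤s (ℕP.m≤n+m (h * e) n)) ⟩
    k + h * e      ≤⟨ ℕP.+-monoʳ-≤ k (ℕP.≤-trans (ℕP.*-monoˡ-≤ e h≤k)
                                                 (ℕP.≤-reflexive (ℕP.*-comm k e))) ⟩
    suc e * k      ∎))
    where open ℕP.≤-Reasoning

parents : ∀ {N x} → 1 ≤ N → IsFarey (suc N) x → ¬ (↧ₙ x ≤ N) → Parents N x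
parents {x = mkℚ -[1+ _ ] _ _} _ (_ , () , _) _
parents {suc n} {mkℚ (+ h) em cx} (s≤s z≤n) (s≤s em≤N , _ , ℤ.+≤+ h≤k) em≰n
  with refl ← ℕP.≤-antisym em≤N (ℕP.≤-pred (ℕP.≰⇒> em≰n))
  = let bm , a , bm<k-1 , bh≡ = inverse-reduced (Cop.recompute cx)
    in mediant-parents {a = a} cx h≤k bm<k-1 bh≡

num den : List ℚ → ℤ
num L = sumℤ (map ↥_ L)
den L = sumℤ (map ↧_ L)

Decomposes : ℕ → ℚ → List ℚ → Set
Decomposes N x L = L ⊆ farey N × ↥ x ≡ num L × ↧ x ≡ den L

parents-decompose : ∀ {N x} (P : Parents N x) →
                    Decomposes N x (Parents.left P ∷ Parents.right P ∷ [])
parents-decompose {N} P =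
  (λ { (here refl)         → farey-complete N left left-farey
      ; (there (here refl)) → farey-complete N right right-farey })
  , trans numerator-sum (cong (λ t → ↥ left ℤ.+ t) (sym (ℤP.+-identityʳ (↥ right))))
  , trans denominator-sum (cong (λ t → ↧ left ℤ.+ t) (sym (ℤP.+-identityʳ (↧ right))))
  where open Parents P

-- A new fraction x ∈ F_{N+1} \ F_N is decomposed by its neighbours x⁻, x⁺ in F_N, because
-- these are its parents: a fraction of F_N strictly between x and a parent would have
-- denominator ≥ ↧x > N.
new-fraction-decomposes : ∀ {N x} → 1 ≤ N → x ∈ farey (suc N) → ¬ x ∈ farey N →
                          Decomposes N x (below x (farey N) ∷ above x (farey N) ∷ [])
new-fraction-decomposes {N} {x} 1≤N x∈ x∉F =
  subst (Decomposes N x) (sym (cong₂ (λ u v → u ∷ v ∷ []) below≡left above≡right))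
    (parents-decompose P)
  where
  x-farey : IsFarey (suc N) x
  x-farey = farey-sound (suc N) x x∈
  ↧x≰N : ¬ (↧ₙ x ≤ N)
  ↧x≰N ↧x≤N = x∉F (farey-complete N x (↧x≤N , proj₂ x-farey))
  P : Parents N x
  P = parents 1≤N x-farey ↧x≰N
  open Parents P
  too-small : ∀ {y} → y ∈ farey N → ↧ₙ x ≤ ↧ₙ y → ⊥
  too-small y∈ ↧x≤↧y = ↧x≰N (ℕP.≤-trans ↧x≤↧y (proj₁ (farey-sound N _ y∈)))
  below≡left : below x (farey N) ≡ left
  below≡left = below-unique (farey-sorted N) (farey-complete N left left-farey)
    (d-positive⇒< (ℤP.≤-reflexive (sym left-adjacent)))
    (λ y∈ left<y y<x → too-small y∈
      (ℕP.≤-trans (ℕP.m≤m+n (↧ₙ x) (↧ₙ left)) (adjacent-gap left-adjacent left<y y<x)))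
  above≡right : above x (farey N) ≡ right
  above≡right = above-unique (farey-sorted N) (farey-complete N right right-farey)
    (d-positive⇒< (ℤP.≤-reflexive (sym right-adjacent)))
    (λ y∈ x<y y<right → too-small y∈
      (ℕP.≤-trans (ℕP.m≤n+m (↧ₙ x) (↧ₙ right)) (adjacent-gap right-adjacent x<y y<right)))

if-dec : ∀ {A B : Set} (A? : Dec A) (p q : B) →
         (A × (if does A? then p else q) ≡ p) ⊎ (¬ A × (if does A? then p else q) ≡ q)
if-dec (yes a) p q = inj₁ (a , refl)
if-dec (no ¬a) p q = inj₂ (¬a , refl)

ε-decomposes : ∀ {N x} → 1 ≤ N → x ∈ farey (suc N) → Decomposes N x (ε N x)
ε-decomposes {N} {x} 1≤N x∈ =
  by-cases (if-dec (x ∈? farey N) (x ∷ []) (below x (farey N) ∷ above x (farey N) ∷ []))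
  where
  by-cases : (x ∈ farey N × ε N x ≡ x ∷ []) ⊎
             (¬ x ∈ farey N × ε N x ≡ below x (farey N) ∷ above x (farey N) ∷ []) →
             Decomposes N x (ε N x)
  by-cases (inj₁ (x∈F , ε≡)) = subst (Decomposes N x) (sym ε≡)
    ((λ { (here refl) → x∈F }) , sym (ℤP.+-identityʳ (↥ x)) , sym (ℤP.+-identityʳ (↧ x)))
  by-cases (inj₂ (x∉F , ε≡)) = subst (Decomposes N x) (sym ε≡) (new-fraction-decomposes 1≤N x∈ x∉F)

doubleSum : (ℚ → ℚ → ℤ) → List ℚ → List ℚ → ℤ
doubleSum f xs ys = sumℤ (concatMap (λ u → map (λ v → f u v) ys) xs)

sumℤ-++ : ∀ xs ys → sumℤ (xs ++ ys) ≡ sumℤ xs ℤ.+ sumℤ ys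
sumℤ-++ []       ys = sym (ℤP.+-identityˡ (sumℤ ys))
sumℤ-++ (x ∷ xs) ys =
  trans (cong (λ t → x ℤ.+ t) (sumℤ-++ xs ys)) (sym (ℤP.+-assoc x (sumℤ xs) (sumℤ ys)))

row-sum : ∀ {f : ℚ → ℚ → ℤ} {u ys} → (∀ {v} → v ∈ ys → f u v ≡ d u v) →
          sumℤ (map (f u) ys) ≡ num ys ℤ.* ↧ u ℤ.- ↥ u ℤ.* den ys
row-sum {u = u} {[]} _ = empty (↧ u) (↥ u)
  where
  empty : ∀ q p → + 0 ≡ + 0 ℤ.* q ℤ.- p ℤ.* + 0
  empty = ℤRing.solve-∀
row-sum {f} {u} {v ∷ ys} agree = begin
  f u v ℤ.+ sumℤ (map (f u) ys)
    ≡⟨ cong₂ ℤ._+_ (agree (here refl)) (row-sum {f} {u} {ys} (λ v∈ → agree (there v∈))) ⟩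
  d u v ℤ.+ (num ys ℤ.* ↧ u ℤ.- ↥ u ℤ.* den ys)
    ≡⟨ linear (↥ v) (↧ v) (↥ u) (↧ u) (num ys) (den ys) ⟩
  num (v ∷ ys) ℤ.* ↧ u ℤ.- ↥ u ℤ.* den (v ∷ ys) ∎
  where
  open ≡-Reasoning
  linear : ∀ p q p′ q′ P Q → (p ℤ.* q′ ℤ.- p′ ℤ.* q) ℤ.+ (P ℤ.* q′ ℤ.- p′ ℤ.* Q)
                             ≡ (p ℤ.+ P) ℤ.* q′ ℤ.- p′ ℤ.* (q ℤ.+ Q)
  linear = ℤRing.solve-∀

double-sum : ∀ {f : ℚ → ℚ → ℤ} {xs ys} → (∀ {u v} → u ∈ xs → v ∈ ys → f u v ≡ d u v) →
             doubleSum f xs ys ≡ num ys ℤ.* den xs ℤ.- num xs ℤ.* den ys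
double-sum {xs = []} {ys} _ = empty (num ys) (den ys)
  where
  empty : ∀ P Q → + 0 ≡ P ℤ.* + 0 ℤ.- + 0 ℤ.* Q
  empty = ℤRing.solve-∀
double-sum {f} {u ∷ xs} {ys} agree = begin
  sumℤ (map (f u) ys ++ concatMap (λ u′ → map (f u′) ys) xs)
    ≡⟨ sumℤ-++ (map (f u) ys) _ ⟩
  sumℤ (map (f u) ys) ℤ.+ doubleSum f xs ys
    ≡⟨ cong₂ ℤ._+_ (row-sum {f} {u} {ys} (agree (here refl)))
                   (double-sum {f} {xs} {ys} (λ u∈ → agree (there u∈))) ⟩
  (P ℤ.* ↧ u ℤ.- ↥ u ℤ.* Q) ℤ.+ (P ℤ.* den xs ℤ.- num xs ℤ.* Q)
    ≡⟨ linear P Q (↥ u) (↧ u) (num xs) (den xs) ⟩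
  P ℤ.* den (u ∷ xs) ℤ.- num (u ∷ xs) ℤ.* Q ∎
  where
  open ≡-Reasoning
  P = num ys
  Q = den ys
  linear : ∀ P Q p q P′ Q′ → (P ℤ.* q ℤ.- p ℤ.* Q) ℤ.+ (P ℤ.* Q′ ℤ.- P′ ℤ.* Q)
                             ≡ P ℤ.* (q ℤ.+ Q′) ℤ.- (p ℤ.+ P′) ℤ.* Q
  linear = ℤRing.solve-∀

farey₁ : ∀ {x} → IsFarey 1 x → x ≡ 0ℚ ⊎ x ≡ 1ℚ
farey₁ {mkℚ (+ 0) 0 _} _ = inj₁ refl
farey₁ {mkℚ (+ 1) 0 _} _ = inj₂ refl
farey₁ {mkℚ (+ suc (suc _)) 0 _} (_ , _ , ℤ.+≤+ (s≤s ()))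
farey₁ {mkℚ (+ _) (suc _) _} (s≤s () , _)
farey₁ {mkℚ -[1+ _ ] _ _} (_ , () , _)

base-case : ∀ {x y} → IsFarey 1 x → IsFarey 1 y → δ 1 x y ≡ d x y
base-case {x} {y} x∈ y∈ with farey₁ {x} x∈ | farey₁ {y} y∈
... | inj₁ refl | inj₁ refl = refl
... | inj₁ refl | inj₂ refl = refl
... | inj₂ refl | inj₁ refl = refl
... | inj₂ refl | inj₂ refl = refl

-- The induction step: δ(N+1) is the double sum of δ(N) = d over ε(x) × ε(y), which by
-- bilinearity is d of the summed vectors, i.e. d x y since ε decomposes x and y.
induction-step : ∀ n → (∀ u v → u ∈ farey (suc n) → v ∈ farey (suc n) → δ (suc n) u v ≡ d u v) →
                 ∀ x y → x ∈ farey (2 + n) → y ∈ farey (2 + n) → δ (2 + n) x y ≡ d x y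
induction-step n hypothesis x y x∈ y∈ =
  let εx⊆ , ↥x≡ , ↧x≡ = ε-decomposes {suc n} {x} (s≤s z≤n) x∈
      εy⊆ , ↥y≡ , ↧y≡ = ε-decomposes {suc n} {y} (s≤s z≤n) y∈
  in begin
  δ (2 + n) x y                                          ≡⟨⟩
  doubleSum (δ (suc n)) (ε (suc n) x) (ε (suc n) y)
    ≡⟨ double-sum {δ (suc n)} {ε (suc n) x} {ε (suc n) y}
         (λ {u} {v} u∈ v∈ → hypothesis u v (εx⊆ u∈) (εy⊆ v∈)) ⟩
  num (ε (suc n) y) ℤ.* den (ε (suc n) x) ℤ.- num (ε (suc n) x) ℤ.* den (ε (suc n) y)
    ≡⟨ cong₂ ℤ._-_ (cong₂ ℤ._*_ ↥y≡ ↧x≡) (cong₂ ℤ._*_ ↥x≡ ↧y≡) ⟨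
  d x y                                                  ∎
  where open ≡-Reasoning

mainTheorem1 : (N : ℕ) → 1 ≤ N → (x y : ℚ) → x ∈ farey N → y ∈ farey N →
    δ N x y ≡ d x y
mainTheorem1 (suc zero)    _ x y x∈ y∈ = base-case {x} {y} (farey-sound 1 x x∈) (farey-sound 1 y y∈)
mainTheorem1 (suc (suc n)) _           = induction-step n (mainTheorem1 (suc n) (s≤s z≤n))
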